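{- Let $D_1,D_2$ be tournament Sidorenko digraphs, and suppose there is an independent set $I\subset V(D_1)$ with $|I|=v(D_2)$ such that all vertices of $I$ have the same in-neighborhood and the same out-neighborhood in $D_1$. Let $D$ be the digraph obtained from $D_1$ by identifying $V(D_2)$ bijectively with $I$ and adding the edges of $D_2$ on $I$ accordingly. Then $D$ is tournament Sidorenko.
   Context: All digraphs are oriented graphs (no loops, no antiparallel edges). A tournament is an orientation of a complete graph without loops. $t_D(T)=h_D(T)/v(T)^{v(D)}$ where $h_D(T)$ is the number of maps $\phi:V(D)\to V(T)$ with $(\phi(x),\phi(y))\in E(T)$ for every $(x,y)\in E(D)$. $D$ is tournament Sidorenko if $t_D(T)\ge(1-o(1))2^{ -e(D)}$ for every tournament $T$, where $o(1)\to0$ as the number of vertices of $T$ tends to infinity. -}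

module Defs where

open import Data.Nat using (ℕ; zero; suc; _+_; _*_; _^_; _≤_)
open import Data.Bool using (Bool; true; false; _∧_; _∨_; not; if_then_else_)
open import Data.Fin using (Fin; zero; suc; _≟_)
open import Data.List using (List; []; _∷_; map; concatMap; allFin; length)
open import Data.Nat.ListAction using (sum)
open import Data.Product using (Σ; ∃; _×_; _,_)
open import Data.Sum using (_⊎_)
open import Relation.Nullary using (¬_)
open import Relation.Nullary.Decidable using (⌊_⌋)
open import Relation.Binary.PropositionalEquality using (_≡_; _≢_)
open import Function.Definitions using (Injective)

record RawDigraph : Set where
  field
    v   : ℕ
    adj : Fin v → Fin v → Bool
open RawDigraph public

record IsOriented (D : RawDigraph) : Set where
  field
    loopless : ∀ x → adj D x x ≡ false
    noAntiparallel : ∀ x y → adj D x y ≡ true → adj D y x ≡ false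

record Tournament : Set where
  field
    graph    : RawDigraph
    oriented : IsOriented graph
    complete : ∀ x y → x ≢ y → (adj graph x y ≡ true) ⊎ (adj graph y x ≡ true)
open Tournament public

boolToℕ : Bool → ℕ
boolToℕ true  = 1
boolToℕ false = 0

sumFin : (n : ℕ) → (Fin n → ℕ) → ℕ
sumFin n f = sum (map f (allFin n))

allFinB : (n : ℕ) → (Fin n → Bool) → Bool
allFinB zero    f = true
allFinB (suc n) f = f zero ∧ allFinB n (λ i → f (suc i))

anyFinB : (n : ℕ) → (Fin n → Bool) → Bool
anyFinB zero    f = false
anyFinB (suc n) f = f zero ∨ anyFinB n (λ i → f (suc i))

edges : RawDigraph → ℕ
edges D = sumFin (v D) (λ x → sumFin (v D) (λ y → boolToℕ (adj D x y)))

consMap : ∀ {k n} → Fin n → (Fin k → Fin n) → Fin (suc k) → Fin n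
consMap i f zero    = i
consMap i f (suc j) = f j

allMaps : (k n : ℕ) → List (Fin k → Fin n)
allMaps zero    n = (λ ()) ∷ []
allMaps (suc k) n = concatMap (λ f → map (λ i → consMap i f) (allFin n)) (allMaps k n)

isHom : (D T : RawDigraph) → (Fin (v D) → Fin (v T)) → Bool
isHom D T φ = allFinB (v D) (λ x → allFinB (v D) (λ y →
                not (adj D x y) ∨ adj T (φ x) (φ y)))

homCount : (D T : RawDigraph) → ℕ
homCount D T = sum (map (λ φ → boolToℕ (isHom D T φ)) (allMaps (v D) (v T)))

-- Tournament Sidorenko: t_D(T) ≥ (1 - o(1)) 2^{-e(D)}, i.e. for every
-- ε = 1/(k+1) there is N such that every tournament T on ≥ N vertices has
-- t_D(T) ≥ (1 - 1/(k+1)) 2^{-e(D)}, i.e.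
-- (k+1) · 2^{e(D)} · h_D(T) ≥ k · v(T)^{v(D)}.
TournamentSidorenko : RawDigraph → Set
TournamentSidorenko D =
  ∀ (k : ℕ) → ∃ λ (N : ℕ) → ∀ (T : Tournament) → N ≤ v (graph T) →
    k * (v (graph T) ^ v D) ≤ suc k * (2 ^ edges D) * homCount D (graph T)

IsTSDigraph : RawDigraph → Set
IsTSDigraph D = IsOriented D × TournamentSidorenko D

-- The digraph obtained from D₁ by identifying V(D₂) with I = image of ι
-- (ι : Fin (v D₂) → Fin (v D₁) injective) and adding the edges of D₂ on I.
glue : (D₁ D₂ : RawDigraph) → (Fin (v D₂) → Fin (v D₁)) → RawDigraph
glue D₁ D₂ ι = record
  { v   = v D₁
  ; adj = λ x y → adj D₁ x y ∨
            anyFinB (v D₂) (λ a → anyFinB (v D₂) (λ b →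
              ⌊ ι a ≟ x ⌋ ∧ ⌊ ι b ≟ y ⌋ ∧ adj D₂ a b))
  }

-- Write I for the image of ι and fix a tournament T on n vertices. As I is independent and its
-- vertices are twins, a map χ : V(D₁) → V(T) is a homomorphism of D₁ iff it preserves the edges of
-- D₁ outside I and maps I into the common neighbourhood S(χ), which only depends on χ outside I;
-- it is a homomorphism of D iff in addition χ restricted to I is a homomorphism of D₂ into T[S(χ)].
-- Freeing the values of χ on I costs a factor n^|I| and gives
--   n^|I| h_D₁(T) = Σ_χ [χ hom outside I] |S(χ)|^|I|,
--   n^|I| h_D(T)  = Σ_χ [χ hom outside I] h_D₂(T[S(χ)]).
-- Applied to each T[S(χ)], the Sidorenko property of D₂ bounds the second sum below by the first,
-- up to an error O(N^|I|) per χ (when |S(χ)| is below the threshold N), which is negligible against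
-- n^|I|. The Sidorenko property of D₁ bounds the first sum, and e(D) ≥ e(D₁) + e(D₂).

module Submission where

open import Defs
open import Data.Fin using (Fin)
open import Data.Bool using (false)
open import Relation.Binary.PropositionalEquality using (_≡_)
open import Function.Definitions using (Injective)

open import Data.Bool using (Bool; true; _∧_; _∨_; not)
open import Data.Bool.Properties using (¬-not; ∨-identityʳ; ∨-conicalˡ; ∨-conicalʳ)
open import Data.Empty using (⊥-elim)
open import Data.Fin using (zero; suc; _≟_)
import Data.Fin.Properties as Finₚ
open import Data.List using (List; []; _∷_; _++_; map; concatMap; allFin)
open import Data.List.Properties using (map-++; map-tabulate)
open import Data.Nat using (ℕ; zero; suc; _+_; _*_; _^_; _≤_; z≤n; s≤s; _≤?_; NonZero; >-nonZero)
open import Data.Nat.ListAction using (sum)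
open import Data.Nat.ListAction.Properties using (sum-++)
open import Data.Nat.Properties
  using ( +-identityʳ; *-identityˡ; *-identityʳ; *-zeroʳ; *-comm; *-assoc; *-distribˡ-+
        ; ≤-refl; ≤-reflexive; ≤-trans; n≤1+n; m≤m+n; m≤n+m; m≤n*m; <⇒≤; ≰⇒>
        ; +-mono-≤; +-monoʳ-≤; *-monoˡ-≤; *-monoʳ-≤; ^-monoˡ-≤; ^-monoʳ-≤
        ; +-cancelʳ-≤; *-cancelʳ-≤; m*n≢0; m^n≢0; ^-distribˡ-+-*; module ≤-Reasoning )
open import Data.Nat.Tactic.RingSolver using (solve-∀)
open import Data.Product using (∃; _×_; _,_; proj₁; proj₂)
open import Data.Sum using (_⊎_; inj₁; inj₂)
open import Data.Vec.Functional using (updateAt)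
open import Data.Vec.Functional.Properties using (updateAt-updates; updateAt-minimal)
open import Function using (_∘_; const)
open import Relation.Nullary using (¬_; yes; no; does)
open import Relation.Nullary.Decidable using (⌊_⌋)
open import Relation.Binary.PropositionalEquality
  using (refl; sym; trans; cong; cong₂; subst₂; _≢_; _≗_; module ≡-Reasoning)

∑ : {A : Set} → List A → (A → ℕ) → ℕ
∑ xs f = sum (map f xs)

syntax ∑ xs (λ x → e) = ∑[ x ∈ xs ] e

private
  variable
    A B : Set

∑-cong : ∀ (xs : List A) {f g : A → ℕ} → (∀ x → f x ≡ g x) → ∑ xs f ≡ ∑ xs g
∑-cong []       eq = refl
∑-cong (x ∷ xs) eq = cong₂ _+_ (eq x) (∑-cong xs eq)

∑-mono-≤ : ∀ (xs : List A) {f g : A → ℕ} → (∀ x → f x ≤ g x) → ∑ xs f ≤ ∑ xs g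
∑-mono-≤ []       le = z≤n
∑-mono-≤ (x ∷ xs) le = +-mono-≤ (le x) (∑-mono-≤ xs le)

∑-zero : ∀ (xs : List A) → ∑[ _ ∈ xs ] 0 ≡ 0
∑-zero []       = refl
∑-zero (_ ∷ xs) = ∑-zero xs

∑-distrib-+ : ∀ (xs : List A) (f g : A → ℕ) → ∑[ x ∈ xs ] (f x + g x) ≡ ∑ xs f + ∑ xs g
∑-distrib-+ []       f g = refl
∑-distrib-+ (x ∷ xs) f g = begin
  f x + g x + ∑[ x ∈ xs ] (f x + g x) ≡⟨ cong (f x + g x +_) (∑-distrib-+ xs f g) ⟩
  f x + g x + (∑ xs f + ∑ xs g)       ≡⟨ +-+-swap (f x) (g x) (∑ xs f) (∑ xs g) ⟩
  f x + ∑ xs f + (g x + ∑ xs g)       ∎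
  where
  open ≡-Reasoning
  +-+-swap : ∀ a b c d → a + b + (c + d) ≡ a + c + (b + d)
  +-+-swap = solve-∀

*-distribˡ-∑ : ∀ (xs : List A) c (f : A → ℕ) → c * ∑ xs f ≡ ∑[ x ∈ xs ] (c * f x)
*-distribˡ-∑ []       c f = *-zeroʳ c
*-distribˡ-∑ (x ∷ xs) c f =
  trans (*-distribˡ-+ c (f x) (∑ xs f)) (cong (c * f x +_) (*-distribˡ-∑ xs c f))

∑-comm : (xs : List A) (ys : List B) (f : A → B → ℕ) →
         ∑[ x ∈ xs ] ∑[ y ∈ ys ] f x y ≡ ∑[ y ∈ ys ] ∑[ x ∈ xs ] f x y
∑-comm []       ys f = sym (∑-zero ys)
∑-comm (x ∷ xs) ys f = begin
  ∑ ys (f x) + ∑[ x ∈ xs ] ∑[ y ∈ ys ] f x y ≡⟨ cong (∑ ys (f x) +_) (∑-comm xs ys f) ⟩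
  ∑ ys (f x) + ∑[ y ∈ ys ] ∑[ x ∈ xs ] f x y ≡⟨ ∑-distrib-+ ys (f x) _ ⟨
  ∑[ y ∈ ys ] (f x y + ∑[ x ∈ xs ] f x y)    ∎
  where open ≡-Reasoning

∑-++ : ∀ (xs ys : List A) (f : A → ℕ) → ∑ (xs ++ ys) f ≡ ∑ xs f + ∑ ys f
∑-++ xs ys f = trans (cong sum (map-++ f xs ys)) (sum-++ (map f xs) (map f ys))

∑-map : (g : B → A) (xs : List B) (f : A → ℕ) → ∑ (map g xs) f ≡ ∑[ x ∈ xs ] f (g x)
∑-map g []       f = refl
∑-map g (x ∷ xs) f = cong (f (g x) +_) (∑-map g xs f)

∑-concatMap : (g : B → List A) (xs : List B) (f : A → ℕ) →
              ∑ (concatMap g xs) f ≡ ∑[ x ∈ xs ] ∑ (g x) f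
∑-concatMap g []       f = refl
∑-concatMap g (x ∷ xs) f =
  trans (∑-++ (g x) (concatMap g xs) f) (cong (∑ (g x) f +_) (∑-concatMap g xs f))

∑-allFin-suc : ∀ n (f : Fin (suc n) → ℕ) → ∑ (allFin (suc n)) f ≡ f zero + ∑[ i ∈ allFin n ] f (suc i)
∑-allFin-suc n f =
  cong (f zero +_) (trans (cong (sum ∘ map f) (sym (map-tabulate (λ i → i) suc)))
                          (∑-map suc (allFin n) f))

∑-allFin-const : ∀ n c → ∑[ _ ∈ allFin n ] c ≡ n * c
∑-allFin-const zero    c = refl
∑-allFin-const (suc n) c = trans (∑-allFin-suc n (const c)) (cong (c +_) (∑-allFin-const n c))

∑-allMaps-suc : ∀ k n (F : (Fin (suc k) → Fin n) → ℕ) →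
                ∑ (allMaps (suc k) n) F ≡ ∑[ f ∈ allMaps k n ] ∑[ i ∈ allFin n ] F (consMap i f)
∑-allMaps-suc k n F = trans (∑-concatMap _ (allMaps k n) F)
  (∑-cong (allMaps k n) (λ f → ∑-map (λ i → consMap i f) (allFin n) F))

∑-allMaps-const : ∀ k n c → ∑[ _ ∈ allMaps k n ] c ≡ n ^ k * c
∑-allMaps-const zero    n c = refl
∑-allMaps-const (suc k) n c = begin
  ∑[ _ ∈ allMaps (suc k) n ] c            ≡⟨ ∑-allMaps-suc k n (const c) ⟩
  ∑[ f ∈ allMaps k n ] ∑[ _ ∈ allFin n ] c ≡⟨ ∑-cong (allMaps k n) (λ _ → ∑-allFin-const n c) ⟩
  ∑[ f ∈ allMaps k n ] (n * c)            ≡⟨ ∑-allMaps-const k n (n * c) ⟩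
  n ^ k * (n * c)                         ≡⟨ rotate (n ^ k) n c ⟩
  n * n ^ k * c                           ∎
  where
  open ≡-Reasoning
  rotate : ∀ a b c → a * (b * c) ≡ b * a * c
  rotate = solve-∀

boolToℕ-∧ : ∀ b c → boolToℕ (b ∧ c) ≡ boolToℕ b * boolToℕ c
boolToℕ-∧ true  c = sym (+-identityʳ _)
boolToℕ-∧ false c = refl

≡-from-⇔true : ∀ {b c} → (b ≡ true → c ≡ true) → (c ≡ true → b ≡ true) → b ≡ c
≡-from-⇔true {true}  b⇒c c⇒b = sym (b⇒c refl)
≡-from-⇔true {false} {true}  b⇒c c⇒b = c⇒b refl
≡-from-⇔true {false} {false} b⇒c c⇒b = refl

∨⁻ : ∀ b {c} → b ∨ c ≡ true → b ≡ true ⊎ c ≡ true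
∨⁻ true  eq = inj₁ refl
∨⁻ false eq = inj₂ eq

∨⁺ʳ : ∀ b {c} → c ≡ true → b ∨ c ≡ true
∨⁺ʳ true  eq = refl
∨⁺ʳ false eq = eq

∨⁺ˡ : ∀ {b} c → b ≡ true → b ∨ c ≡ true
∨⁺ˡ c refl = refl

∨-false⁺ : ∀ {b c} → b ≡ false → c ≡ false → b ∨ c ≡ false
∨-false⁺ refl refl = refl

∧⁻ : ∀ b {c} → b ∧ c ≡ true → b ≡ true × c ≡ true
∧⁻ true eq = refl , eq

∧⁺ : ∀ {b c} → b ≡ true → c ≡ true → b ∧ c ≡ true
∧⁺ refl refl = refl

not∨⁺ : ∀ b {c} → (b ≡ true → c ≡ true) → not b ∨ c ≡ true
not∨⁺ true  b⇒c = b⇒c refl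
not∨⁺ false b⇒c = refl

not∨⁻ : ∀ b {c} → not b ∨ c ≡ true → b ≡ true → c ≡ true
not∨⁻ true eq refl = eq

boolToℕ-mono : ∀ {b c} → (b ≡ true → c ≡ true) → boolToℕ b ≤ boolToℕ c
boolToℕ-mono {true}  b⇒c rewrite b⇒c refl = ≤-refl
boolToℕ-mono {false} b⇒c = z≤n

boolToℕ-∨-disjoint : ∀ b {c} → (c ≡ true → b ≡ false) → boolToℕ (b ∨ c) ≡ boolToℕ b + boolToℕ c
boolToℕ-∨-disjoint true  {true}  c⇒¬b with () ← c⇒¬b refl
boolToℕ-∨-disjoint true  {false} c⇒¬b = refl
boolToℕ-∨-disjoint false         c⇒¬b = refl

⌊≟⌋-refl : ∀ {n} (x : Fin n) → ⌊ x ≟ x ⌋ ≡ true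
⌊≟⌋-refl x with x ≟ x
... | yes _   = refl
... | no  x≢x = ⊥-elim (x≢x refl)

⌊≟⌋-true⁻ : ∀ {n} {x y : Fin n} → ⌊ x ≟ y ⌋ ≡ true → x ≡ y
⌊≟⌋-true⁻ {x = x} {y} eq with x ≟ y
... | yes x≡y = x≡y

⌊≟⌋-false⁻ : ∀ {n} {x y : Fin n} → ⌊ x ≟ y ⌋ ≡ false → x ≢ y
⌊≟⌋-false⁻ {x = x} {y} eq with x ≟ y
... | no x≢y = x≢y

allFinB⁺ : ∀ n {f : Fin n → Bool} → (∀ i → f i ≡ true) → allFinB n f ≡ true
allFinB⁺ zero    all = refl
allFinB⁺ (suc n) all rewrite all zero = allFinB⁺ n (all ∘ suc)

allFinB⁻ : ∀ n {f : Fin n → Bool} → allFinB n f ≡ true → ∀ i → f i ≡ true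
allFinB⁻ (suc n) {f} eq zero    = proj₁ (∧⁻ (f zero) eq)
allFinB⁻ (suc n) {f} eq (suc i) = allFinB⁻ n (proj₂ (∧⁻ (f zero) eq)) i

allFinB-cong : ∀ n {f g : Fin n → Bool} → (∀ i → f i ≡ g i) → allFinB n f ≡ allFinB n g
allFinB-cong zero    eq = refl
allFinB-cong (suc n) eq = cong₂ _∧_ (eq zero) (allFinB-cong n (eq ∘ suc))

anyFinB⁺ : ∀ n {f : Fin n → Bool} i → f i ≡ true → anyFinB n f ≡ true
anyFinB⁺ (suc n) zero    eq rewrite eq = refl
anyFinB⁺ (suc n) {f} (suc i) eq = ∨⁺ʳ (f zero) (anyFinB⁺ n i eq)

anyFinB⁻ : ∀ n {f : Fin n → Bool} → anyFinB n f ≡ true → ∃ λ i → f i ≡ true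
anyFinB⁻ (suc n) {f} eq with ∨⁻ (f zero) eq
... | inj₁ here  = zero , here
... | inj₂ there with anyFinB⁻ n there
...   | i , fi = suc i , fi

anyFinB-false⁻ : ∀ n {f : Fin n → Bool} → anyFinB n f ≡ false → ∀ i → f i ≡ false
anyFinB-false⁻ (suc n) {f} eq zero    = ∨-conicalˡ (f zero) _ eq
anyFinB-false⁻ (suc n) {f} eq (suc i) = anyFinB-false⁻ n (∨-conicalʳ (f zero) _ eq) i

anyFinB-empty : ∀ n {f : Fin n → Bool} → ¬ Fin n → anyFinB n f ≡ false
anyFinB-empty zero    _     = refl
anyFinB-empty (suc n) empty = ⊥-elim (empty zero)

isHom⁺ : ∀ D T φ → (∀ x y → adj D x y ≡ true → adj T (φ x) (φ y) ≡ true) → isHom D T φ ≡ true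
isHom⁺ D T φ hom = allFinB⁺ _ (λ x → allFinB⁺ _ (λ y → not∨⁺ (adj D x y) (hom x y)))

isHom⁻ : ∀ D T φ → isHom D T φ ≡ true → ∀ x y → adj D x y ≡ true → adj T (φ x) (φ y) ≡ true
isHom⁻ D T φ eq x y = not∨⁻ (adj D x y) (allFinB⁻ _ (allFinB⁻ _ eq x) y)

isHom-cong : ∀ D T {φ ψ} → φ ≗ ψ → isHom D T φ ≡ isHom D T ψ
isHom-cong D T φ≗ψ = allFinB-cong _ (λ x → allFinB-cong _ (λ y →
  cong (not (adj D x y) ∨_) (cong₂ (adj T) (φ≗ψ x) (φ≗ψ y))))

Extensional : ((A → B) → ℕ) → Set
Extensional F = ∀ {χ χ′} → χ ≗ χ′ → F χ ≡ F χ′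

consMap-cong : ∀ {k n} (i : Fin n) {f g : Fin k → Fin n} → f ≗ g → consMap i f ≗ consMap i g
consMap-cong i eq zero    = refl
consMap-cong i eq (suc x) = eq x

∑-allMaps-updateAt : ∀ k n (p : Fin k) (F : (Fin k → Fin n) → ℕ) → Extensional F →
  ∑[ χ ∈ allMaps k n ] ∑[ i ∈ allFin n ] F (updateAt χ p (const i)) ≡ n * ∑ (allMaps k n) F
∑-allMaps-updateAt (suc k) n zero F F-ext = begin
  ∑[ χ ∈ allMaps (suc k) n ] ∑[ i ∈ allFin n ] F (updateAt χ zero (const i))
    ≡⟨ ∑-allMaps-suc k n _ ⟩
  ∑[ f ∈ allMaps k n ] ∑[ j ∈ allFin n ] ∑[ i ∈ allFin n ] F (updateAt (consMap j f) zero (const i))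
    ≡⟨ ∑-cong (allMaps k n) (λ f → ∑-cong (allFin n) (λ j → ∑-cong (allFin n) (λ i →
         F-ext (λ { zero → refl ; (suc x) → refl })))) ⟩
  ∑[ f ∈ allMaps k n ] ∑[ j ∈ allFin n ] ∑[ i ∈ allFin n ] F (consMap i f)
    ≡⟨ ∑-cong (allMaps k n) (λ f → ∑-allFin-const n _) ⟩
  ∑[ f ∈ allMaps k n ] (n * ∑[ i ∈ allFin n ] F (consMap i f))
    ≡⟨ *-distribˡ-∑ (allMaps k n) n _ ⟨
  n * ∑[ f ∈ allMaps k n ] ∑[ i ∈ allFin n ] F (consMap i f)
    ≡⟨ cong (n *_) (∑-allMaps-suc k n F) ⟨
  n * ∑ (allMaps (suc k) n) F ∎
  where open ≡-Reasoning
∑-allMaps-updateAt (suc k) n (suc p) F F-ext = begin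
  ∑[ χ ∈ allMaps (suc k) n ] ∑[ i ∈ allFin n ] F (updateAt χ (suc p) (const i))
    ≡⟨ ∑-allMaps-suc k n _ ⟩
  ∑[ f ∈ allMaps k n ] ∑[ j ∈ allFin n ] ∑[ i ∈ allFin n ] F (updateAt (consMap j f) (suc p) (const i))
    ≡⟨ ∑-cong (allMaps k n) (λ f → ∑-cong (allFin n) (λ j → ∑-cong (allFin n) (λ i →
         F-ext (λ { zero → refl ; (suc x) → refl })))) ⟩
  ∑[ f ∈ allMaps k n ] ∑[ j ∈ allFin n ] ∑[ i ∈ allFin n ] F (consMap j (updateAt f p (const i)))
    ≡⟨ ∑-comm (allMaps k n) (allFin n) _ ⟩
  ∑[ j ∈ allFin n ] ∑[ f ∈ allMaps k n ] ∑[ i ∈ allFin n ] F (consMap j (updateAt f p (const i)))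
    ≡⟨ ∑-cong (allFin n) (λ j →
         ∑-allMaps-updateAt k n p (F ∘ consMap j) (F-ext ∘ consMap-cong j)) ⟩
  ∑[ j ∈ allFin n ] (n * ∑[ f ∈ allMaps k n ] F (consMap j f))
    ≡⟨ *-distribˡ-∑ (allFin n) n _ ⟨
  n * ∑[ j ∈ allFin n ] ∑[ f ∈ allMaps k n ] F (consMap j f)
    ≡⟨ cong (n *_) (∑-comm (allFin n) (allMaps k n) _) ⟩
  n * ∑[ f ∈ allMaps k n ] ∑[ j ∈ allFin n ] F (consMap j f)
    ≡⟨ cong (n *_) (∑-allMaps-suc k n F) ⟨
  n * ∑ (allMaps (suc k) n) F ∎
  where open ≡-Reasoning

AgreeOffImage : ∀ {m v} → (Fin m → Fin v) → (Fin v → A) → (Fin v → A) → Set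
AgreeOffImage ι χ χ′ = ∀ x → (∀ a → ι a ≢ x) → χ x ≡ χ′ x

-- The values of χ on the image of ι are freed one at a time by ∑-allMaps-updateAt,
-- each at the cost of a factor n.
∑-allMaps-decouple : ∀ m v n (ι : Fin m → Fin v) → Injective _≡_ _≡_ ι →
  (K : (Fin v → Fin n) → (Fin m → Fin n) → ℕ) →
  (∀ {χ χ′ σ σ′} → AgreeOffImage ι χ χ′ → σ ≗ σ′ → K χ σ ≡ K χ′ σ′) →
  n ^ m * ∑[ χ ∈ allMaps v n ] K χ (χ ∘ ι) ≡ ∑[ χ ∈ allMaps v n ] ∑[ σ ∈ allMaps m n ] K χ σ
∑-allMaps-decouple zero    v n ι ι-inj K K-cong = trans (+-identityʳ _)
  (∑-cong (allMaps v n) (λ χ → trans (K-cong (λ _ _ → refl) (λ ())) (sym (+-identityʳ _))))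
∑-allMaps-decouple (suc m) v n ι ι-inj K K-cong = begin
  n ^ suc m * ∑ (allMaps v n) F
    ≡⟨ reassoc (n ^ m) n _ ⟩
  n ^ m * (n * ∑ (allMaps v n) F)
    ≡⟨ cong (n ^ m *_) (∑-allMaps-updateAt v n (ι zero) F F-ext) ⟨
  n ^ m * ∑[ χ ∈ allMaps v n ] ∑[ i ∈ allFin n ] F (updateAt χ (ι zero) (const i))
    ≡⟨ cong (n ^ m *_) (∑-cong (allMaps v n) (λ χ → ∑-cong (allFin n) (F-updateAt χ))) ⟩
  n ^ m * ∑[ χ ∈ allMaps v n ] ∑[ i ∈ allFin n ] K χ (consMap i (χ ∘ ι ∘ suc))
    ≡⟨ cong (n ^ m *_) (∑-comm (allMaps v n) (allFin n) _) ⟩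
  n ^ m * ∑[ i ∈ allFin n ] ∑[ χ ∈ allMaps v n ] K χ (consMap i (χ ∘ ι ∘ suc))
    ≡⟨ *-distribˡ-∑ (allFin n) (n ^ m) _ ⟩
  ∑[ i ∈ allFin n ] (n ^ m * ∑[ χ ∈ allMaps v n ] K χ (consMap i (χ ∘ ι ∘ suc)))
    ≡⟨ ∑-cong (allFin n) (λ i → ∑-allMaps-decouple m v n (ι ∘ suc) (Finₚ.suc-injective ∘ ι-inj)
         (λ χ σ → K χ (consMap i σ))
         (λ χ≈χ′ σ≗σ′ → K-cong (λ x x∉ι → χ≈χ′ x (x∉ι ∘ suc)) (consMap-cong i σ≗σ′))) ⟩
  ∑[ i ∈ allFin n ] ∑[ χ ∈ allMaps v n ] ∑[ σ ∈ allMaps m n ] K χ (consMap i σ)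
    ≡⟨ ∑-comm (allFin n) (allMaps v n) _ ⟩
  ∑[ χ ∈ allMaps v n ] ∑[ i ∈ allFin n ] ∑[ σ ∈ allMaps m n ] K χ (consMap i σ)
    ≡⟨ ∑-cong (allMaps v n) (λ χ → ∑-comm (allFin n) (allMaps m n) _) ⟩
  ∑[ χ ∈ allMaps v n ] ∑[ σ ∈ allMaps m n ] ∑[ i ∈ allFin n ] K χ (consMap i σ)
    ≡⟨ ∑-cong (allMaps v n) (λ χ → ∑-allMaps-suc m n (K χ)) ⟨
  ∑[ χ ∈ allMaps v n ] ∑ (allMaps (suc m) n) (K χ) ∎
  where
  open ≡-Reasoning
  F : (Fin v → Fin n) → ℕ
  F χ = K χ (χ ∘ ι)
  F-ext : Extensional F
  F-ext eq = K-cong (λ x _ → eq x) (eq ∘ ι)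
  reassoc : ∀ a b c → b * a * c ≡ a * (b * c)
  reassoc = solve-∀
  F-updateAt : ∀ χ i → F (updateAt χ (ι zero) (const i)) ≡ K χ (consMap i (χ ∘ ι ∘ suc))
  F-updateAt χ i = K-cong (λ x x∉ι → updateAt-minimal x (ι zero) χ (x∉ι zero ∘ sym))
    λ { zero    → updateAt-updates (ι zero) χ
      ; (suc a) → updateAt-minimal (ι (suc a)) (ι zero) χ (Finₚ.0≢1+n ∘ ι-inj ∘ sym) }

sucIf : Bool → ℕ → ℕ
sucIf true  c = suc c
sucIf false c = c

card : (n : ℕ) → (Fin n → Bool) → ℕ
card zero    p = 0
card (suc n) p = sucIf (p zero) (card n (p ∘ suc))

enumStep : ∀ {c n} b → (Fin c → Fin n) → Fin (sucIf b c) → Fin (suc n)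
enumStep true  e zero    = zero
enumStep true  e (suc i) = suc (e i)
enumStep false e i       = suc (e i)

enum : ∀ n (p : Fin n → Bool) → Fin (card n p) → Fin n
enum (suc n) p = enumStep (p zero) (enum n (p ∘ suc))

enum-injective : ∀ n p → Injective _≡_ _≡_ (enum n p)
enum-injective (suc n) p = step (p zero) (enum-injective n (p ∘ suc))
  where
  step : ∀ {c} b {e : Fin c → Fin n} → Injective _≡_ _≡_ e → Injective _≡_ _≡_ (enumStep b e)
  step true  e-inj {zero}  {zero}  _  = refl
  step true  e-inj {suc i} {suc j} eq = cong suc (e-inj (Finₚ.suc-injective eq))
  step false e-inj                 eq = e-inj (Finₚ.suc-injective eq)

∑-allFin-enum : ∀ n (p : Fin n → Bool) (H : Fin n → ℕ) →
  ∑[ i ∈ allFin (card n p) ] H (enum n p i) ≡ ∑[ j ∈ allFin n ] (boolToℕ (p j) * H j)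
∑-allFin-enum zero    p H = refl
∑-allFin-enum (suc n) p H = begin
  ∑[ i ∈ allFin (card (suc n) p) ] H (enum (suc n) p i)
    ≡⟨ ∑-enumStep (p zero) ⟩
  boolToℕ (p zero) * H zero + ∑[ i ∈ allFin (card n (p ∘ suc)) ] H (suc (enum n (p ∘ suc) i))
    ≡⟨ cong (boolToℕ (p zero) * H zero +_) (∑-allFin-enum n (p ∘ suc) (H ∘ suc)) ⟩
  boolToℕ (p zero) * H zero + ∑[ j ∈ allFin n ] (boolToℕ (p (suc j)) * H (suc j))
    ≡⟨ ∑-allFin-suc n _ ⟨
  ∑[ j ∈ allFin (suc n) ] (boolToℕ (p j) * H j) ∎
  where
  open ≡-Reasoning
  c : ℕ
  c = card n (p ∘ suc)
  e : Fin c → Fin n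
  e = enum n (p ∘ suc)
  ∑-enumStep : ∀ b → ∑[ i ∈ allFin (sucIf b c) ] H (enumStep b e i)
                   ≡ boolToℕ b * H zero + ∑[ i ∈ allFin c ] H (suc (e i))
  ∑-enumStep true  = trans (∑-allFin-suc c (H ∘ enumStep true e))
                           (cong (_+ ∑[ i ∈ allFin c ] H (suc (e i))) (sym (*-identityˡ (H zero))))
  ∑-enumStep false = refl

∑-allMaps-enum : ∀ m n (p : Fin n → Bool) (G : (Fin m → Fin n) → ℕ) → Extensional G →
  ∑[ σ ∈ allMaps m (card n p) ] G (enum n p ∘ σ)
    ≡ ∑[ τ ∈ allMaps m n ] (boolToℕ (allFinB m (p ∘ τ)) * G τ)
∑-allMaps-enum zero    n p G G-ext = cong (_+ 0) (trans (G-ext (λ ())) (sym (+-identityʳ _)))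
∑-allMaps-enum (suc m) n p G G-ext = begin
  ∑[ σ ∈ allMaps (suc m) s ] G (e ∘ σ)
    ≡⟨ ∑-allMaps-suc m s _ ⟩
  ∑[ σ ∈ allMaps m s ] ∑[ i ∈ allFin s ] G (e ∘ consMap i σ)
    ≡⟨ ∑-cong (allMaps m s) (λ σ → ∑-cong (allFin s) (λ i →
         G-ext (λ { zero → refl ; (suc a) → refl }))) ⟩
  ∑[ σ ∈ allMaps m s ] ∑[ i ∈ allFin s ] G (consMap (e i) (e ∘ σ))
    ≡⟨ ∑-comm (allMaps m s) (allFin s) _ ⟩
  ∑[ i ∈ allFin s ] ∑[ σ ∈ allMaps m s ] G (consMap (e i) (e ∘ σ))
    ≡⟨ ∑-cong (allFin s) (λ i →
         ∑-allMaps-enum m n p (G ∘ consMap (e i)) (G-ext ∘ consMap-cong (e i))) ⟩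
  ∑[ i ∈ allFin s ] ∑[ τ ∈ allMaps m n ] (inside τ * G (consMap (e i) τ))
    ≡⟨ ∑-comm (allFin s) (allMaps m n) _ ⟩
  ∑[ τ ∈ allMaps m n ] ∑[ i ∈ allFin s ] (inside τ * G (consMap (e i) τ))
    ≡⟨ ∑-cong (allMaps m n) (λ τ → *-distribˡ-∑ (allFin s) (inside τ) _) ⟨
  ∑[ τ ∈ allMaps m n ] (inside τ * ∑[ i ∈ allFin s ] G (consMap (e i) τ))
    ≡⟨ ∑-cong (allMaps m n) (λ τ → cong (inside τ *_) (∑-allFin-enum n p (G ∘ λ j → consMap j τ))) ⟩
  ∑[ τ ∈ allMaps m n ] (inside τ * ∑[ j ∈ allFin n ] (boolToℕ (p j) * G (consMap j τ)))
    ≡⟨ ∑-cong (allMaps m n) (λ τ → *-distribˡ-∑ (allFin n) (inside τ) _) ⟩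
  ∑[ τ ∈ allMaps m n ] ∑[ j ∈ allFin n ] (inside τ * (boolToℕ (p j) * G (consMap j τ)))
    ≡⟨ ∑-cong (allMaps m n) (λ τ → ∑-cong (allFin n) (λ j → inside-cons τ j)) ⟩
  ∑[ τ ∈ allMaps m n ] ∑[ j ∈ allFin n ] (inside (consMap j τ) * G (consMap j τ))
    ≡⟨ ∑-allMaps-suc m n _ ⟨
  ∑[ τ ∈ allMaps (suc m) n ] (boolToℕ (allFinB (suc m) (p ∘ τ)) * G τ) ∎
  where
  open ≡-Reasoning
  s : ℕ
  s = card n p
  e : Fin s → Fin n
  e = enum n p
  inside : ∀ {k} → (Fin k → Fin n) → ℕ
  inside {k} τ = boolToℕ (allFinB k (p ∘ τ))
  inside-cons : ∀ τ j → inside τ * (boolToℕ (p j) * G (consMap j τ))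
                      ≡ inside (consMap j τ) * G (consMap j τ)
  inside-cons τ j = begin
    inside τ * (boolToℕ (p j) * G (consMap j τ)) ≡⟨ swap (inside τ) (boolToℕ (p j)) _ ⟩
    boolToℕ (p j) * inside τ * G (consMap j τ)   ≡⟨ cong (_* G (consMap j τ)) (boolToℕ-∧ (p j) _) ⟨
    inside (consMap j τ) * G (consMap j τ)       ∎
    where
    swap : ∀ a b c → a * (b * c) ≡ b * a * c
    swap = solve-∀

induced : (T : Tournament) → (Fin (v (graph T)) → Bool) → Tournament
induced T p = record
  { graph    = record { v = card n p ; adj = λ i j → adj (graph T) (e i) (e j) }
  ; oriented = record
    { loopless       = λ i → IsOriented.loopless (oriented T) (e i)
    ; noAntiparallel = λ i j → IsOriented.noAntiparallel (oriented T) (e i) (e j)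
    }
  ; complete = λ i j i≢j → complete T (e i) (e j) (i≢j ∘ enum-injective n p)
  }
  where
  n : ℕ
  n = v (graph T)
  e : Fin (card n p) → Fin n
  e = enum n p

homCount-induced : ∀ D T (p : Fin (v (graph T)) → Bool) →
  homCount D (graph (induced T p))
    ≡ ∑[ τ ∈ allMaps (v D) (v (graph T)) ]
        (boolToℕ (allFinB (v D) (p ∘ τ)) * boolToℕ (isHom D (graph T) τ))
homCount-induced D T p =
  ∑-allMaps-enum (v D) _ p (boolToℕ ∘ isHom D (graph T)) (cong boolToℕ ∘ isHom-cong D (graph T))

card-^ : ∀ m n (p : Fin n → Bool) → card n p ^ m ≡ ∑[ τ ∈ allMaps m n ] boolToℕ (allFinB m (p ∘ τ))
card-^ m n p = begin
  card n p ^ m                                           ≡⟨ *-identityʳ _ ⟨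
  card n p ^ m * 1                                       ≡⟨ ∑-allMaps-const m (card n p) 1 ⟨
  ∑[ _ ∈ allMaps m (card n p) ] 1                        ≡⟨ ∑-allMaps-enum m n p (const 1) (const refl) ⟩
  ∑[ τ ∈ allMaps m n ] (boolToℕ (allFinB m (p ∘ τ)) * 1) ≡⟨ ∑-cong (allMaps m n) (λ _ → *-identityʳ _) ⟩
  ∑[ τ ∈ allMaps m n ] boolToℕ (allFinB m (p ∘ τ))       ∎
  where open ≡-Reasoning

-- Stated with does rather than ⌊_⌋, which does not compute on suc x ≟ suc y.
∑-indicator : ∀ n (f : Fin n → ℕ) y → ∑[ x ∈ allFin n ] (boolToℕ (does (y ≟ x)) * f x) ≡ f y
∑-indicator (suc n) f zero = begin
  ∑[ x ∈ allFin (suc n) ] (boolToℕ (does (zero ≟ x)) * f x)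
    ≡⟨ ∑-allFin-suc n _ ⟩
  1 * f zero + ∑[ _ ∈ allFin n ] 0
    ≡⟨ cong₂ _+_ (*-identityˡ (f zero)) (∑-zero (allFin n)) ⟩
  f zero + 0
    ≡⟨ +-identityʳ (f zero) ⟩
  f zero ∎
  where open ≡-Reasoning
∑-indicator (suc n) f (suc y) =
  trans (∑-allFin-suc n (λ x → boolToℕ (does (suc y ≟ x)) * f x)) (∑-indicator n (λ x → f (suc x)) y)

∑-indicator-injective-≤1 : ∀ m {n} (ι : Fin m → Fin n) → Injective _≡_ _≡_ ι →
  ∀ x → ∑[ a ∈ allFin m ] boolToℕ (does (ι a ≟ x)) ≤ 1
∑-indicator-injective-≤1 zero    ι ι-inj x = z≤n
∑-indicator-injective-≤1 (suc m) ι ι-inj x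
  rewrite ∑-allFin-suc m (λ a → boolToℕ (does (ι a ≟ x))) with ι zero ≟ x
... | yes refl = s≤s (≤-reflexive (trans (∑-cong (allFin m) missed) (∑-zero (allFin m))))
  where
  missed : ∀ a → boolToℕ (does (ι (suc a) ≟ ι zero)) ≡ 0
  missed a with ι (suc a) ≟ ι zero
  ... | yes eq = ⊥-elim (Finₚ.0≢1+n (ι-inj (sym eq)))
  ... | no  _  = refl
... | no  _    = ∑-indicator-injective-≤1 m (ι ∘ suc) (Finₚ.suc-injective ∘ ι-inj) x

∑-∘-injective-≤ : ∀ m n (ι : Fin m → Fin n) → Injective _≡_ _≡_ ι → (f : Fin n → ℕ) →
  ∑[ a ∈ allFin m ] f (ι a) ≤ ∑ (allFin n) f
∑-∘-injective-≤ m n ι ι-inj f = begin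
  ∑[ a ∈ allFin m ] f (ι a)
    ≡⟨ ∑-cong (allFin m) (λ a → ∑-indicator n f (ι a)) ⟨
  ∑[ a ∈ allFin m ] ∑[ x ∈ allFin n ] (boolToℕ (does (ι a ≟ x)) * f x)
    ≡⟨ ∑-comm (allFin m) (allFin n) _ ⟩
  ∑[ x ∈ allFin n ] ∑[ a ∈ allFin m ] (boolToℕ (does (ι a ≟ x)) * f x)
    ≡⟨ ∑-cong (allFin n) (λ x → trans (∑-cong (allFin m) (λ a → *-comm _ (f x)))
                                      (sym (*-distribˡ-∑ (allFin m) (f x) _))) ⟩
  ∑[ x ∈ allFin n ] (f x * ∑[ a ∈ allFin m ] boolToℕ (does (ι a ≟ x)))
    ≤⟨ ∑-mono-≤ (allFin n) (λ x → *-monoʳ-≤ (f x) (∑-indicator-injective-≤1 m ι ι-inj x)) ⟩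
  ∑[ x ∈ allFin n ] (f x * 1)
    ≡⟨ ∑-cong (allFin n) (λ x → *-identityʳ (f x)) ⟩
  ∑ (allFin n) f ∎
  where open ≤-Reasoning

1+2k-slack : ∀ k → let K = suc (2 * k) in k * (suc K * suc K) + suc k ≤ suc k * (K * K)
1+2k-slack k = ≤-reflexive (identity k)
  where
  identity : ∀ k → k * ((2 + 2 * k) * (2 + 2 * k)) + suc k ≡ suc k * ((1 + 2 * k) * (1 + 2 * k))
  identity = solve-∀

-- Multiplying the bound for D₁ by K P and inserting the bound for the glued digraph gives
-- K² P V ≤ (K+1)² E₁ E₂ P h + P V; the slack condition on K then absorbs the error P V.
combine-Sidorenko-bounds : ∀ k K {V P h₁ h E₁ E₂ M} .{{_ : NonZero P}} →
  k * (suc K * suc K) + suc k ≤ suc k * (K * K) →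
  K * V ≤ suc K * E₁ * h₁ →
  K * (P * h₁) ≤ suc K * E₂ * (P * h) + V * (K * M) →
  suc K * K * E₁ * M ≤ P →
  k * V ≤ suc k * (E₁ * E₂) * h
combine-Sidorenko-bounds k K {V} {P} {h₁} {h} {E₁} {E₂} {M} slack bound₁ bound₂ small =
  *-cancelʳ-≤ (k * V) (suc k * (E₁ * E₂) * h) (suc K * suc K * P)
    {{m*n≢0 _ P {{m*n≢0 (suc K) (suc K)}}}}
    (+-cancelʳ-≤ (suc k * (P * V)) _ _ scaled)
  where
  open ≤-Reasoning
  bound : K * K * (P * V) ≤ suc K * suc K * (E₁ * E₂) * (P * h) + P * V
  bound = begin
    K * K * (P * V)                                         ≡⟨ solve₁ K P V ⟩
    K * P * (K * V)                                         ≤⟨ *-monoʳ-≤ (K * P) bound₁ ⟩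
    K * P * (suc K * E₁ * h₁)                               ≡⟨ solve₂ K P (suc K * E₁) h₁ ⟩
    suc K * E₁ * (K * (P * h₁))                             ≤⟨ *-monoʳ-≤ (suc K * E₁) bound₂ ⟩
    suc K * E₁ * (suc K * E₂ * (P * h) + V * (K * M))       ≡⟨ solve₃ (suc K) K E₁ E₂ P h V M ⟩
    suc K * suc K * (E₁ * E₂) * (P * h) + suc K * K * E₁ * M * V
      ≤⟨ +-monoʳ-≤ (suc K * suc K * (E₁ * E₂) * (P * h)) (*-monoˡ-≤ V small) ⟩
    suc K * suc K * (E₁ * E₂) * (P * h) + P * V             ∎
    where
    solve₁ : ∀ K P V → K * K * (P * V) ≡ K * P * (K * V)
    solve₁ = solve-∀
    solve₂ : ∀ K P a h₁ → K * P * (a * h₁) ≡ a * (K * (P * h₁))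
    solve₂ = solve-∀
    solve₃ : ∀ L K E₁ E₂ P h V M →
      L * E₁ * (L * E₂ * (P * h) + V * (K * M)) ≡ L * L * (E₁ * E₂) * (P * h) + L * K * E₁ * M * V
    solve₃ = solve-∀
  scaled : k * V * (suc K * suc K * P) + suc k * (P * V)
         ≤ suc k * (E₁ * E₂) * h * (suc K * suc K * P) + suc k * (P * V)
  scaled = begin
    k * V * (suc K * suc K * P) + suc k * (P * V)          ≡⟨ solve₄ k (suc K) V P ⟩
    (k * (suc K * suc K) + suc k) * (P * V)                ≤⟨ *-monoˡ-≤ (P * V) slack ⟩
    suc k * (K * K) * (P * V)                              ≡⟨ *-assoc (suc k) (K * K) (P * V) ⟩
    suc k * (K * K * (P * V))                              ≤⟨ *-monoʳ-≤ (suc k) bound ⟩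
    suc k * (suc K * suc K * (E₁ * E₂) * (P * h) + P * V)  ≡⟨ solve₅ (suc k) (suc K) (E₁ * E₂) P h V ⟩
    suc k * (E₁ * E₂) * h * (suc K * suc K * P) + suc k * (P * V) ∎
    where
    solve₄ : ∀ k L V P → k * V * (L * L * P) + suc k * (P * V) ≡ (k * (L * L) + suc k) * (P * V)
    solve₄ = solve-∀
    solve₅ : ∀ l L E P h V → l * (L * L * E * (P * h) + P * V) ≡ l * E * h * (L * L * P) + l * (P * V)
    solve₅ = solve-∀

m*n≤o⇒m*n^k≤o^k : ∀ {m n o} k .{{_ : NonZero m}} .{{_ : NonZero k}} → m * n ≤ o → m * n ^ k ≤ o ^ k
m*n≤o⇒m*n^k≤o^k {m} {n} {o} (suc k) mn≤o = begin
  m * (n * n ^ k)  ≡⟨ *-assoc m n (n ^ k) ⟨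
  m * n * n ^ k    ≤⟨ *-monoˡ-≤ (n ^ k) mn≤o ⟩
  o * n ^ k        ≤⟨ *-monoʳ-≤ o (^-monoˡ-≤ k (≤-trans (m≤n*m n m) mn≤o)) ⟩
  o * o ^ k        ∎
  where open ≤-Reasoning

¬Fin⊎Fin : ∀ n → ¬ Fin n ⊎ Fin n
¬Fin⊎Fin zero    = inj₁ λ ()
¬Fin⊎Fin (suc n) = inj₂ zero

SidorenkoFrom : RawDigraph → ℕ → ℕ → Set
SidorenkoFrom D k N = ∀ (T : Tournament) → N ≤ v (graph T) →
  k * (v (graph T) ^ v D) ≤ suc k * (2 ^ edges D) * homCount D (graph T)

-- Below the threshold N the trivial bound h ≥ 0 loses at most k N^{v(D)}.
SidorenkoFrom⇒bound-up-to-error : ∀ D {k N} → SidorenkoFrom D k N → ∀ T →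
  k * (v (graph T) ^ v D) ≤ suc k * (2 ^ edges D) * homCount D (graph T) + k * N ^ v D
SidorenkoFrom⇒bound-up-to-error D {k} {N} bound T with N ≤? v (graph T)
... | yes N≤n = ≤-trans (bound T N≤n) (m≤m+n _ _)
... | no  N≰n = ≤-trans (*-monoʳ-≤ k (^-monoˡ-≤ (v D) (<⇒≤ (≰⇒> N≰n)))) (m≤n+m _ _)

TournamentSidorenko-cong : ∀ {D} {adj′ : Fin (v D) → Fin (v D) → Bool} →
  (∀ x y → adj D x y ≡ adj′ x y) →
  TournamentSidorenko D → TournamentSidorenko (record { v = v D ; adj = adj′ })
TournamentSidorenko-cong {D} {adj′} adj≡adj′ TS k with TS k
... | N , bound = N , λ T N≤n →
  subst₂ (λ e h → k * (v (graph T) ^ v D) ≤ suc k * 2 ^ e * h)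
         edges-eq (homCount-eq (graph T)) (bound T N≤n)
  where
  edges-eq : edges D ≡ edges (record { v = v D ; adj = adj′ })
  edges-eq = ∑-cong (allFin (v D)) λ x → ∑-cong (allFin (v D)) λ y → cong boolToℕ (adj≡adj′ x y)
  homCount-eq : ∀ T → homCount D T ≡ homCount (record { v = v D ; adj = adj′ }) T
  homCount-eq T = ∑-cong (allMaps (v D) (v T)) λ φ → cong boolToℕ
    (allFinB-cong (v D) λ x → allFinB-cong (v D) λ y →
       cong (λ b → not b ∨ adj T (φ x) (φ y)) (adj≡adj′ x y))

module Gluing (D₁ D₂ : RawDigraph) (ι : Fin (v D₂) → Fin (v D₁)) (ι-inj : Injective _≡_ _≡_ ι)
  (I-independent : ∀ a b → adj D₁ (ι a) (ι b) ≡ false)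
  (I-sameIn : ∀ a b z → adj D₁ z (ι a) ≡ adj D₁ z (ι b))
  (I-sameOut : ∀ a b z → adj D₁ (ι a) z ≡ adj D₁ (ι b) z) where

  m v₁ : ℕ
  m  = v D₂
  v₁ = v D₁

  G : RawDigraph
  G = glue D₁ D₂ ι

  newEdge : Fin v₁ → Fin v₁ → Bool
  newEdge x y = anyFinB m (λ a → anyFinB m (λ b → ⌊ ι a ≟ x ⌋ ∧ ⌊ ι b ≟ y ⌋ ∧ adj D₂ a b))

  newEdge⁺ : ∀ {a b} → adj D₂ a b ≡ true → newEdge (ι a) (ι b) ≡ true
  newEdge⁺ {a} {b} e = anyFinB⁺ m a (anyFinB⁺ m b (∧⁺ (⌊≟⌋-refl (ι a)) (∧⁺ (⌊≟⌋-refl (ι b)) e)))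

  newEdge⁻ : ∀ {x y} → newEdge x y ≡ true →
             ∃ λ a → ∃ λ b → ι a ≡ x × ι b ≡ y × adj D₂ a b ≡ true
  newEdge⁻ {x} {y} e with anyFinB⁻ m e
  ... | a , e′ with anyFinB⁻ m e′
  ...   | b , e″ with ∧⁻ ⌊ ι a ≟ x ⌋ e″
  ...     | ιa≟x , e‴ with ∧⁻ ⌊ ι b ≟ y ⌋ e‴
  ...       | ιb≟y , e₂ = a , b , ⌊≟⌋-true⁻ ιa≟x , ⌊≟⌋-true⁻ ιb≟y , e₂

  newEdge⇒¬adj₁ : ∀ {x y} → newEdge x y ≡ true → adj D₁ x y ≡ false
  newEdge⇒¬adj₁ e with newEdge⁻ e
  ... | a , b , refl , refl , _ = I-independent a b

  glue-oriented : IsOriented D₁ → IsOriented D₂ → IsOriented G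
  glue-oriented o₁ o₂ = record { loopless = loopless ; noAntiparallel = noAntiparallel }
    where
    open IsOriented using () renaming (loopless to loopless₀; noAntiparallel to noAntiparallel₀)
    noLoop : ∀ {x} → newEdge x x ≢ true
    noLoop e with newEdge⁻ e
    ... | a , b , ιa≡x , ιb≡x , e₂ with ι-inj (trans ιa≡x (sym ιb≡x))
    ...   | refl with () ← trans (sym (loopless₀ o₂ a)) e₂
    loopless : ∀ x → adj G x x ≡ false
    loopless x = ∨-false⁺ (loopless₀ o₁ x) (¬-not noLoop)
    noReverse : ∀ {a b} → adj D₂ a b ≡ true → newEdge (ι b) (ι a) ≢ true
    noReverse {a} {b} e₂ e with newEdge⁻ e
    ... | c , d , ιc≡ιb , ιd≡ιa , e₂′ with ι-inj ιc≡ιb | ι-inj ιd≡ιa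
    ...   | refl | refl with () ← trans (sym (noAntiparallel₀ o₂ a b e₂)) e₂′
    noReverse₁ : ∀ {x y} → adj D₁ x y ≡ true → newEdge y x ≢ true
    noReverse₁ e₁ e with newEdge⁻ e
    ... | c , d , refl , refl , _ with () ← trans (sym e₁) (I-independent d c)
    noAntiparallel : ∀ x y → adj G x y ≡ true → adj G y x ≡ false
    noAntiparallel x y e with ∨⁻ (adj D₁ x y) e
    ... | inj₁ e₁ = ∨-false⁺ (noAntiparallel₀ o₁ x y e₁) (¬-not (noReverse₁ e₁))
    ... | inj₂ eₙ with newEdge⁻ eₙ
    ...   | a , b , refl , refl , e₂ = ∨-false⁺ (I-independent b a) (¬-not (noReverse e₂))

  edges-glue : edges D₁ + edges D₂ ≤ edges G
  edges-glue = begin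
    edges D₁ + edges D₂
      ≤⟨ +-monoʳ-≤ (edges D₁) new-edges ⟩
    edges D₁ + ∑[ x ∈ allFin v₁ ] ∑[ y ∈ allFin v₁ ] boolToℕ (newEdge x y)
      ≡⟨ ∑-distrib-+ (allFin v₁) _ _ ⟨
    ∑[ x ∈ allFin v₁ ]
      (∑[ y ∈ allFin v₁ ] boolToℕ (adj D₁ x y) + ∑[ y ∈ allFin v₁ ] boolToℕ (newEdge x y))
      ≡⟨ ∑-cong (allFin v₁) (λ x → ∑-distrib-+ (allFin v₁) _ _) ⟨
    ∑[ x ∈ allFin v₁ ] ∑[ y ∈ allFin v₁ ] (boolToℕ (adj D₁ x y) + boolToℕ (newEdge x y))
      ≡⟨ ∑-cong (allFin v₁) (λ x → ∑-cong (allFin v₁) (λ y →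
           boolToℕ-∨-disjoint (adj D₁ x y) newEdge⇒¬adj₁)) ⟨
    edges G ∎
    where
    open ≤-Reasoning
    new-edges : edges D₂ ≤ ∑[ x ∈ allFin v₁ ] ∑[ y ∈ allFin v₁ ] boolToℕ (newEdge x y)
    new-edges = begin
      edges D₂
        ≤⟨ ∑-mono-≤ (allFin m) (λ a → ∑-mono-≤ (allFin m) (λ b → boolToℕ-mono newEdge⁺)) ⟩
      ∑[ a ∈ allFin m ] ∑[ b ∈ allFin m ] boolToℕ (newEdge (ι a) (ι b))
        ≤⟨ ∑-mono-≤ (allFin m) (λ a → ∑-∘-injective-≤ m v₁ ι ι-inj (boolToℕ ∘ newEdge (ι a))) ⟩
      ∑[ a ∈ allFin m ] ∑[ y ∈ allFin v₁ ] boolToℕ (newEdge (ι a) y)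
        ≤⟨ ∑-∘-injective-≤ m v₁ ι ι-inj (λ x → ∑[ y ∈ allFin v₁ ] boolToℕ (newEdge x y)) ⟩
      ∑[ x ∈ allFin v₁ ] ∑[ y ∈ allFin v₁ ] boolToℕ (newEdge x y) ∎

  inI : Fin v₁ → Bool
  inI x = anyFinB m (λ a → ⌊ ι a ≟ x ⌋)

  ∈I : ∀ {x} → inI x ≡ true → ∃ λ a → ι a ≡ x
  ∈I e with anyFinB⁻ m e
  ... | a , ιa≟x = a , ⌊≟⌋-true⁻ ιa≟x

  ∉I : ∀ {x} → inI x ≡ false → ∀ a → ι a ≢ x
  ∉I e a = ⌊≟⌋-false⁻ (anyFinB-false⁻ m e a)

  module Counting (T : Tournament) where

    n : ℕ
    n = v (graph T)

    adjT : Fin n → Fin n → Bool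
    adjT = adj (graph T)

    homOutsideI : (Fin v₁ → Fin n) → Bool
    homOutsideI χ = allFinB v₁ λ x → allFinB v₁ λ y →
      not (adj D₁ x y) ∨ inI x ∨ inI y ∨ adjT (χ x) (χ y)

    compatible : (Fin v₁ → Fin n) → Fin n → Fin m → Fin v₁ → Bool
    compatible χ w a z = (not (adj D₁ z (ι a)) ∨ adjT (χ z) w) ∧ (not (adj D₁ (ι a) z) ∨ adjT w (χ z))

    -- The common neighbourhood S(χ) of the paper.
    admissible : (Fin v₁ → Fin n) → Fin n → Bool
    admissible χ w = allFinB m λ a → allFinB v₁ (compatible χ w a)

    allAdmissible : (Fin v₁ → Fin n) → (Fin m → Fin n) → Bool
    allAdmissible χ τ = allFinB m (admissible χ ∘ τ)

    homOutsideI⁻ : ∀ {χ} → homOutsideI χ ≡ true → ∀ {x y} → inI x ≡ false → inI y ≡ false →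
                   adj D₁ x y ≡ true → adjT (χ x) (χ y) ≡ true
    homOutsideI⁻ hom {x} {y} x∉I y∉I e
      with not∨⁻ (adj D₁ x y) (allFinB⁻ v₁ (allFinB⁻ v₁ hom x) y) e
    ... | edge rewrite x∉I | y∉I = edge

    admissible⁻ : ∀ {χ w} → admissible χ w ≡ true → ∀ a z →
      (adj D₁ z (ι a) ≡ true → adjT (χ z) w ≡ true) × (adj D₁ (ι a) z ≡ true → adjT w (χ z) ≡ true)
    admissible⁻ {χ} {w} adm a z
      with ∧⁻ (not (adj D₁ z (ι a)) ∨ adjT (χ z) w) (allFinB⁻ v₁ (allFinB⁻ m adm a) z)
    ... | into , out = not∨⁻ (adj D₁ z (ι a)) into , not∨⁻ (adj D₁ (ι a) z) out

    homOutsideI-cong : ∀ {χ χ′} → AgreeOffImage ι χ χ′ → homOutsideI χ ≡ homOutsideI χ′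
    homOutsideI-cong {χ} {χ′} χ≈χ′ = allFinB-cong v₁ λ x → allFinB-cong v₁ (pointwise x)
      where
      pointwise : ∀ x y → (not (adj D₁ x y) ∨ inI x ∨ inI y ∨ adjT (χ x) (χ y))
                        ≡ (not (adj D₁ x y) ∨ inI x ∨ inI y ∨ adjT (χ′ x) (χ′ y))
      pointwise x y with inI x in x∈?I | inI y in y∈?I
      ... | true  | _     = refl
      ... | false | true  = refl
      ... | false | false =
        cong (not (adj D₁ x y) ∨_) (cong₂ adjT (χ≈χ′ x (∉I x∈?I)) (χ≈χ′ y (∉I y∈?I)))

    admissible-cong : ∀ {χ χ′} → AgreeOffImage ι χ χ′ → ∀ w → admissible χ w ≡ admissible χ′ w
    admissible-cong {χ} {χ′} χ≈χ′ w = allFinB-cong m λ a → allFinB-cong v₁ (pointwise a)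
      where
      pointwise : ∀ a z → compatible χ w a z ≡ compatible χ′ w a z
      pointwise a z with inI z in z∈?I
      ... | false = cong (λ t → (not (adj D₁ z (ι a)) ∨ adjT t w) ∧ (not (adj D₁ (ι a) z) ∨ adjT w t))
                         (χ≈χ′ z (∉I z∈?I))
      ... | true with ∈I z∈?I
      ...   | c , refl rewrite I-independent c a | I-independent a c = refl

    isHom-D₁-split : ∀ χ → isHom D₁ (graph T) χ ≡ homOutsideI χ ∧ allAdmissible χ (χ ∘ ι)
    isHom-D₁-split χ = ≡-from-⇔true split merge
      where
      hom⁻ : isHom D₁ (graph T) χ ≡ true → ∀ x y → adj D₁ x y ≡ true → adjT (χ x) (χ y) ≡ true
      hom⁻ = isHom⁻ D₁ (graph T) χ
      split : isHom D₁ (graph T) χ ≡ true → homOutsideI χ ∧ allAdmissible χ (χ ∘ ι) ≡ true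
      split hom = ∧⁺
        (allFinB⁺ v₁ λ x → allFinB⁺ v₁ λ y → not∨⁺ (adj D₁ x y) λ e →
           ∨⁺ʳ (inI x) (∨⁺ʳ (inI y) (hom⁻ hom x y e)))
        (allFinB⁺ m λ a → allFinB⁺ m λ b → allFinB⁺ v₁ λ z → ∧⁺
           (not∨⁺ (adj D₁ z (ι b)) λ e → hom⁻ hom z (ι a) (trans (I-sameIn a b z) e))
           (not∨⁺ (adj D₁ (ι b) z) λ e → hom⁻ hom (ι a) z (trans (I-sameOut a b z) e)))
      merge : homOutsideI χ ∧ allAdmissible χ (χ ∘ ι) ≡ true → isHom D₁ (graph T) χ ≡ true
      merge both with ∧⁻ (homOutsideI χ) both
      ... | off , adm = isHom⁺ D₁ (graph T) χ edge
        where
        edge : ∀ x y → adj D₁ x y ≡ true → adjT (χ x) (χ y) ≡ true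
        edge x y e with inI x in x∈?I | inI y in y∈?I
        ... | true | _ with ∈I x∈?I
        ...   | a , refl = proj₂ (admissible⁻ (allFinB⁻ m adm a) a y) e
        edge x y e | false | true with ∈I y∈?I
        ...   | b , refl = proj₁ (admissible⁻ (allFinB⁻ m adm b) b x) e
        edge x y e | false | false = homOutsideI⁻ off x∈?I y∈?I e

    isHom-glue-split : ∀ χ → isHom G (graph T) χ ≡ isHom D₁ (graph T) χ ∧ isHom D₂ (graph T) (χ ∘ ι)
    isHom-glue-split χ = ≡-from-⇔true split merge
      where
      hom⁻ : isHom G (graph T) χ ≡ true → ∀ x y → adj G x y ≡ true → adjT (χ x) (χ y) ≡ true
      hom⁻ = isHom⁻ G (graph T) χ
      split : isHom G (graph T) χ ≡ true → isHom D₁ (graph T) χ ∧ isHom D₂ (graph T) (χ ∘ ι) ≡ true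
      split hom = ∧⁺
        (isHom⁺ D₁ (graph T) χ λ x y e → hom⁻ hom x y (∨⁺ˡ (newEdge x y) e))
        (isHom⁺ D₂ (graph T) (χ ∘ ι) λ a b e →
           hom⁻ hom (ι a) (ι b) (∨⁺ʳ (adj D₁ (ι a) (ι b)) (newEdge⁺ e)))
      merge : isHom D₁ (graph T) χ ∧ isHom D₂ (graph T) (χ ∘ ι) ≡ true → isHom G (graph T) χ ≡ true
      merge both with ∧⁻ (isHom D₁ (graph T) χ) both
      ... | hom₁ , hom₂ = isHom⁺ G (graph T) χ edge
        where
        edge : ∀ x y → adj G x y ≡ true → adjT (χ x) (χ y) ≡ true
        edge x y e with ∨⁻ (adj D₁ x y) e
        ... | inj₁ e₁ = isHom⁻ D₁ (graph T) χ hom₁ x y e₁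
        ... | inj₂ eₙ with newEdge⁻ eₙ
        ...   | a , b , refl , refl , e₂ = isHom⁻ D₂ (graph T) (χ ∘ ι) hom₂ a b e₂

    hom : (D : RawDigraph) → (Fin (v D) → Fin n) → ℕ
    hom D φ = boolToℕ (isHom D (graph T) φ)

    ∑-hom-D₁-decouple : (g : (Fin m → Fin n) → ℕ) → Extensional g →
      n ^ m * ∑[ χ ∈ allMaps v₁ n ] (hom D₁ χ * g (χ ∘ ι))
        ≡ ∑[ χ ∈ allMaps v₁ n ]
            (boolToℕ (homOutsideI χ) * ∑[ τ ∈ allMaps m n ] (boolToℕ (allAdmissible χ τ) * g τ))
    ∑-hom-D₁-decouple g g-ext = begin
      n ^ m * ∑[ χ ∈ allMaps v₁ n ] (hom D₁ χ * g (χ ∘ ι))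
        ≡⟨ cong (n ^ m *_) (∑-cong (allMaps v₁ n) split) ⟩
      n ^ m * ∑[ χ ∈ allMaps v₁ n ] K χ (χ ∘ ι)
        ≡⟨ ∑-allMaps-decouple m v₁ n ι ι-inj K K-cong ⟩
      ∑[ χ ∈ allMaps v₁ n ] ∑[ τ ∈ allMaps m n ] K χ τ
        ≡⟨ ∑-cong (allMaps v₁ n) (λ χ → *-distribˡ-∑ (allMaps m n) (boolToℕ (homOutsideI χ)) _) ⟨
      ∑[ χ ∈ allMaps v₁ n ]
        (boolToℕ (homOutsideI χ) * ∑[ τ ∈ allMaps m n ] (boolToℕ (allAdmissible χ τ) * g τ)) ∎
      where
      open ≡-Reasoning
      K : (Fin v₁ → Fin n) → (Fin m → Fin n) → ℕ
      K χ τ = boolToℕ (homOutsideI χ) * (boolToℕ (allAdmissible χ τ) * g τ)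
      K-cong : ∀ {χ χ′ τ τ′} → AgreeOffImage ι χ χ′ → τ ≗ τ′ → K χ τ ≡ K χ′ τ′
      K-cong χ≈χ′ τ≗τ′ = cong₂ _*_ (cong boolToℕ (homOutsideI-cong χ≈χ′)) (cong₂ _*_
        (cong boolToℕ (allFinB-cong m λ a →
           trans (admissible-cong χ≈χ′ _) (cong (admissible _) (τ≗τ′ a))))
        (g-ext τ≗τ′))
      split : ∀ χ → hom D₁ χ * g (χ ∘ ι) ≡ K χ (χ ∘ ι)
      split χ = begin
        hom D₁ χ * g (χ ∘ ι)
          ≡⟨ cong (λ b → boolToℕ b * g (χ ∘ ι)) (isHom-D₁-split χ) ⟩
        boolToℕ (homOutsideI χ ∧ allAdmissible χ (χ ∘ ι)) * g (χ ∘ ι)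
          ≡⟨ cong (_* g (χ ∘ ι)) (boolToℕ-∧ (homOutsideI χ) _) ⟩
        boolToℕ (homOutsideI χ) * boolToℕ (allAdmissible χ (χ ∘ ι)) * g (χ ∘ ι)
          ≡⟨ *-assoc (boolToℕ (homOutsideI χ)) _ _ ⟩
        K χ (χ ∘ ι) ∎

    homCount-D₁ : n ^ m * homCount D₁ (graph T)
                ≡ ∑[ χ ∈ allMaps v₁ n ] (boolToℕ (homOutsideI χ) * card n (admissible χ) ^ m)
    homCount-D₁ = begin
      n ^ m * ∑ (allMaps v₁ n) (hom D₁)
        ≡⟨ cong (n ^ m *_) (∑-cong (allMaps v₁ n) (λ χ → *-identityʳ _)) ⟨
      n ^ m * ∑[ χ ∈ allMaps v₁ n ] (hom D₁ χ * 1)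
        ≡⟨ ∑-hom-D₁-decouple (const 1) (const refl) ⟩
      ∑[ χ ∈ allMaps v₁ n ]
        (boolToℕ (homOutsideI χ) * ∑[ τ ∈ allMaps m n ] (boolToℕ (allAdmissible χ τ) * 1))
        ≡⟨ ∑-cong (allMaps v₁ n) (λ χ → cong (boolToℕ (homOutsideI χ) *_) (trans
             (∑-cong (allMaps m n) (λ _ → *-identityʳ _)) (sym (card-^ m n (admissible χ))))) ⟩
      ∑[ χ ∈ allMaps v₁ n ] (boolToℕ (homOutsideI χ) * card n (admissible χ) ^ m) ∎
      where open ≡-Reasoning

    homCount-glue : n ^ m * homCount G (graph T)
                  ≡ ∑[ χ ∈ allMaps v₁ n ]
                      (boolToℕ (homOutsideI χ) * homCount D₂ (graph (induced T (admissible χ))))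
    homCount-glue = begin
      n ^ m * ∑ (allMaps v₁ n) (hom G)
        ≡⟨ cong (n ^ m *_) (∑-cong (allMaps v₁ n) split) ⟩
      n ^ m * ∑[ χ ∈ allMaps v₁ n ] (hom D₁ χ * hom D₂ (χ ∘ ι))
        ≡⟨ ∑-hom-D₁-decouple (hom D₂) (cong boolToℕ ∘ isHom-cong D₂ (graph T)) ⟩
      ∑[ χ ∈ allMaps v₁ n ]
        (boolToℕ (homOutsideI χ) * ∑[ τ ∈ allMaps m n ] (boolToℕ (allAdmissible χ τ) * hom D₂ τ))
        ≡⟨ ∑-cong (allMaps v₁ n) (λ χ →
             cong (boolToℕ (homOutsideI χ) *_) (sym (homCount-induced D₂ T (admissible χ)))) ⟩
      ∑[ χ ∈ allMaps v₁ n ] (boolToℕ (homOutsideI χ) * homCount D₂ (graph (induced T (admissible χ)))) ∎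
      where
      open ≡-Reasoning
      split : ∀ χ → hom G χ ≡ hom D₁ χ * hom D₂ (χ ∘ ι)
      split χ = trans (cong boolToℕ (isHom-glue-split χ)) (boolToℕ-∧ (isHom D₁ (graph T) χ) _)

    homCount-glue-≥ : ∀ {K N} → SidorenkoFrom D₂ K N →
      K * (n ^ m * homCount D₁ (graph T))
        ≤ suc K * 2 ^ edges D₂ * (n ^ m * homCount G (graph T)) + n ^ v₁ * (K * N ^ m)
    homCount-glue-≥ {K} {N} bound = begin
      K * (n ^ m * homCount D₁ (graph T))
        ≡⟨ cong (K *_) homCount-D₁ ⟩
      K * ∑[ χ ∈ allMaps v₁ n ] (boolToℕ (homOutsideI χ) * card n (admissible χ) ^ m)
        ≡⟨ *-distribˡ-∑ (allMaps v₁ n) K _ ⟩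
      ∑[ χ ∈ allMaps v₁ n ] (K * (boolToℕ (homOutsideI χ) * card n (admissible χ) ^ m))
        ≤⟨ ∑-mono-≤ (allMaps v₁ n) (λ χ → gate (homOutsideI χ)
             (SidorenkoFrom⇒bound-up-to-error D₂ {K} bound (induced T (admissible χ)))) ⟩
      ∑[ χ ∈ allMaps v₁ n ] (c * (boolToℕ (homOutsideI χ) * h₂ χ) + K * N ^ m)
        ≡⟨ ∑-distrib-+ (allMaps v₁ n) _ _ ⟩
      ∑[ χ ∈ allMaps v₁ n ] (c * (boolToℕ (homOutsideI χ) * h₂ χ)) + ∑[ _ ∈ allMaps v₁ n ] (K * N ^ m)
        ≡⟨ cong₂ _+_ (*-distribˡ-∑ (allMaps v₁ n) c _) (sym (∑-allMaps-const v₁ n _)) ⟨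
      c * ∑[ χ ∈ allMaps v₁ n ] (boolToℕ (homOutsideI χ) * h₂ χ) + n ^ v₁ * (K * N ^ m)
        ≡⟨ cong (λ t → c * t + n ^ v₁ * (K * N ^ m)) homCount-glue ⟨
      c * (n ^ m * homCount G (graph T)) + n ^ v₁ * (K * N ^ m) ∎
      where
      open ≤-Reasoning
      c : ℕ
      c = suc K * 2 ^ edges D₂
      h₂ : (Fin v₁ → Fin n) → ℕ
      h₂ χ = homCount D₂ (graph (induced T (admissible χ)))
      gate : ∀ b {x y e} → K * x ≤ c * y + e → K * (boolToℕ b * x) ≤ c * (boolToℕ b * y) + e
      gate false _ = ≤-trans (≤-reflexive (*-zeroʳ K)) z≤n
      gate true {x} {y} le rewrite +-identityʳ x | +-identityʳ y = le

  glue-TournamentSidorenko-empty : ¬ Fin m → TournamentSidorenko D₁ → TournamentSidorenko G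
  glue-TournamentSidorenko-empty I-empty = TournamentSidorenko-cong λ x y →
    sym (trans (cong (adj D₁ x y ∨_) (anyFinB-empty m I-empty)) (∨-identityʳ (adj D₁ x y)))

  -- Precision K for D₁ and D₂ suffices by 1+2k-slack, and n ≥ C N₂ makes the error term
  -- coming from small common neighbourhoods negligible.
  glue-TournamentSidorenko-nonempty : Fin m →
    TournamentSidorenko D₁ → TournamentSidorenko D₂ → TournamentSidorenko G
  glue-TournamentSidorenko-nonempty a TS₁ TS₂ k = suc (N₁ + C * N₂) , bound
    where
    K N₁ N₂ C : ℕ
    K  = suc (2 * k)
    N₁ = proj₁ (TS₁ K)
    N₂ = proj₁ (TS₂ K)
    C  = suc K * K * 2 ^ edges D₁
    instance
      C≢0 : NonZero C
      C≢0 = m*n≢0 (suc K * K) (2 ^ edges D₁) {{_}} {{m^n≢0 2 (edges D₁)}}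
      m≢0 : NonZero m
      m≢0 = Finₚ.nonZeroIndex a
    bound : SidorenkoFrom G k (suc (N₁ + C * N₂))
    bound T N<n = ≤-trans
      (combine-Sidorenko-bounds k K {h₁ = homCount D₁ (graph T)} {E₁ = 2 ^ edges D₁} {E₂ = 2 ^ edges D₂}
         {{m^n≢0 n m}} (1+2k-slack k)
         (proj₂ (TS₁ K) T (≤-trans (m≤m+n N₁ (C * N₂)) N₁+CN₂≤n))
         (Counting.homCount-glue-≥ T {K} (proj₂ (TS₂ K)))
         (m*n≤o⇒m*n^k≤o^k m (≤-trans (m≤n+m (C * N₂) N₁) N₁+CN₂≤n)))
      (*-monoˡ-≤ (homCount G (graph T)) (*-monoʳ-≤ (suc k) 2^edges))
      where
      n : ℕ
      n = v (graph T)
      N₁+CN₂≤n : N₁ + C * N₂ ≤ n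
      N₁+CN₂≤n = ≤-trans (n≤1+n _) N<n
      instance
        n≢0 : NonZero n
        n≢0 = >-nonZero (≤-trans (s≤s z≤n) N<n)
      2^edges : 2 ^ edges D₁ * 2 ^ edges D₂ ≤ 2 ^ edges G
      2^edges = ≤-trans (≤-reflexive (sym (^-distribˡ-+-* 2 (edges D₁) (edges D₂))))
                        (^-monoʳ-≤ 2 edges-glue)

  glue-TournamentSidorenko : TournamentSidorenko D₁ → TournamentSidorenko D₂ → TournamentSidorenko G
  glue-TournamentSidorenko TS₁ TS₂ with ¬Fin⊎Fin m
  ... | inj₁ I-empty = glue-TournamentSidorenko-empty I-empty TS₁
  ... | inj₂ a       = glue-TournamentSidorenko-nonempty a TS₁ TS₂

proposition4p5 : (D₁ D₂ : RawDigraph) → IsTSDigraph D₁ → IsTSDigraph D₂ →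
    (ι : Fin (v D₂) → Fin (v D₁)) → Injective _≡_ _≡_ ι →
    (∀ a b → adj D₁ (ι a) (ι b) ≡ false) →
    (∀ a b z → adj D₁ z (ι a) ≡ adj D₁ z (ι b)) →
    (∀ a b z → adj D₁ (ι a) z ≡ adj D₁ (ι b) z) →
    IsTSDigraph (glue D₁ D₂ ι)
proposition4p5 D₁ D₂ (o₁ , TS₁) (o₂ , TS₂) ι ι-inj I-independent I-sameIn I-sameOut =
  glue-oriented o₁ o₂ , glue-TournamentSidorenko TS₁ TS₂
  where open Gluing D₁ D₂ ι ι-inj I-independent I-sameIn I-sameOut
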